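{- Let $r_1, r_2$ be two ridges of $C^d$ such that $r_1\cup r_2$ does not contain a pair of antipodal peaks. Then either there is a coordinate position that both $r_1$ and $r_2$ fix at the same coordinate value, or the sets of two coordinate positions fixed by $r_1$ and by $r_2$ are disjoint.
   Context: $C^d=[0,1]^d$. A nonempty $k$-face of $C^d$ is given by a word in $\{0,1,X\}^d$ with exactly $k$ letters $X$; the non-$X$ positions are the fixed coordinate positions, with their values, and the face is the set of points agreeing with the word there. The empty set is the face of dimension $-1$ and is antipodal to itself. Two $k$-faces are antipodal iff they have exactly the same fixed positions and differ in every fixed position. A ridge is a $(d-2)$-face (two fixed positions) and a peak is a $(d-3)$-face. A set contains a pair of antipodal peaks if two antipodal peaks are both contained in it.
   Formalization: The points of $C^d$ that decide whether $r_1\cup r_2$ contains a peak are taken with rational coordinates in [0,1] rather than real ones. -}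

module Defs where

open import Data.Nat using (ℕ; zero; suc; _+_)
open import Data.Fin using (Fin; zero; suc)
open import Data.Rational using (ℚ; 0ℚ; 1ℚ; _≤_)
open import Data.Product using (Σ; _×_; _,_)
open import Data.Sum using (_⊎_)
open import Data.Unit using (⊤)
open import Relation.Binary.PropositionalEquality using (_≡_; _≢_)
open import Function using (_∘_)

-- Letters of a face word: fixed to 0, fixed to 1, or free (X).
data Letter : Set where
  𝟎 𝟏 X : Letter

Word : ℕ → Set
Word d = Fin d → Letter

-- Faces of C^d: the empty face (dimension -1) or a nonempty face given by a word.
data Face (d : ℕ) : Set where
  empty : Face d
  word  : Word d → Face d

isFixed : Letter → ℕ
isFixed 𝟎 = 1
isFixed 𝟏 = 1
isFixed X = 0

-- number of fixed positions (= d - dimension)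
nfixed : ∀ {d} → Word d → ℕ
nfixed {zero}  w = 0
nfixed {suc d} w = isFixed (w zero) + nfixed (w ∘ suc)

Point : ℕ → Set
Point d = Fin d → ℚ

InCube : ∀ {d} → Point d → Set
InCube p = ∀ i → (0ℚ ≤ p i) × (p i ≤ 1ℚ)

agrees : Letter → ℚ → Set
agrees 𝟎 q = q ≡ 0ℚ
agrees 𝟏 q = q ≡ 1ℚ
agrees X q = ⊤

_∈W_ : ∀ {d} → Point d → Word d → Set
p ∈W w = ∀ i → agrees (w i) (p i)

data _∈F_ {d : ℕ} (p : Point d) : Face d → Set where
  inWord : ∀ {w} → p ∈W w → p ∈F word w

-- A ridge: a (d-2)-face, i.e. a word with exactly two fixed positions.
IsRidge : ∀ {d} → Word d → Set
IsRidge w = nfixed w ≡ 2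

-- A peak: a (d-3)-face. The empty face has dimension -1, so it is a peak iff d = 2.
IsPeak : ∀ {d} → Face d → Set
IsPeak {d} empty = d ≡ 2
IsPeak (word w) = nfixed w ≡ 3

data AntiLetter : Letter → Letter → Set where
  a01 : AntiLetter 𝟎 𝟏
  a10 : AntiLetter 𝟏 𝟎
  aXX : AntiLetter X X

data Antipodal {d : ℕ} : Face d → Face d → Set where
  antiEmpty : Antipodal empty empty
  antiWord  : ∀ {v w} → (∀ i → AntiLetter (v i) (w i)) → Antipodal (word v) (word w)

_⊆_∪_ : ∀ {d} → Face d → Word d → Word d → Set
_⊆_∪_ {d} F r1 r2 = (p : Point d) → InCube p → p ∈F F → (p ∈W r1) ⊎ (p ∈W r2)

ContainsAntipodalPeaks : ∀ {d} → Word d → Word d → Set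
ContainsAntipodalPeaks {d} r1 r2 =
  Σ (Face d) λ F → Σ (Face d) λ G →
    IsPeak F × IsPeak G × Antipodal F G × (F ⊆ r1 ∪ r2) × (G ⊆ r1 ∪ r2)

-- Say r₁ fixes {i, j} and r₂ fixes {i, k} with r₁ i ≠ r₂ i, so that r₂ i is the antipode
-- of r₁ i. If j ≠ k, fix k in r₁ opposite to r₂ k: the resulting peak lies in r₁ and its
-- antipodal peak lies in r₂. If j = k and r₁ j ≠ r₂ j, then r₂ is the antipodal ridge of r₁;
-- fixing any free position of r₁ gives a peak in r₁ whose antipode lies in r₂, and when
-- there is no free position, d = 2 and the empty face is a self-antipodal peak.
module Submission where

open import Defs
open import Data.Nat using (ℕ; zero; suc; _+_)
open import Data.Nat.Properties using (suc-injective; m+n≡0⇒m≡0; m+n≡0⇒n≡0; +-commutativeSemigroup)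
open import Algebra.Properties.CommutativeSemigroup +-commutativeSemigroup using (x∙yz≈y∙xz)
open import Data.Fin using (Fin; zero; suc)
open import Data.Fin.Properties using (any?) renaming (_≟_ to _≟ᶠ_)
open import Data.Product using (Σ; _×_; _,_; proj₁; proj₂)
open import Data.Sum using (_⊎_; inj₁; inj₂)
open import Data.Unit using (tt)
open import Data.Vec.Functional using (updateAt)
open import Data.Vec.Functional.Properties using (updateAt-updates; updateAt-minimal)
open import Function using (_∘_; id; const)
open import Relation.Binary.Definitions using (DecidableEquality)
open import Relation.Binary.PropositionalEquality
  using (_≡_; _≢_; refl; sym; trans; cong; cong₂; subst; module ≡-Reasoning)
open import Relation.Nullary using (¬_; yes; no; contradiction)
open import Relation.Nullary.Decidable using (_×-dec_; ¬?)

_≟ᴸ_ : DecidableEquality Letter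
𝟎 ≟ᴸ 𝟎 = yes refl
𝟎 ≟ᴸ 𝟏 = no λ ()
𝟎 ≟ᴸ X = no λ ()
𝟏 ≟ᴸ 𝟎 = no λ ()
𝟏 ≟ᴸ 𝟏 = yes refl
𝟏 ≟ᴸ X = no λ ()
X ≟ᴸ 𝟎 = no λ ()
X ≟ᴸ 𝟏 = no λ ()
X ≟ᴸ X = yes refl

antipode : Letter → Letter
antipode 𝟎 = 𝟏
antipode 𝟏 = 𝟎
antipode X = X

antipode-involutive : ∀ a → antipode (antipode a) ≡ a
antipode-involutive 𝟎 = refl
antipode-involutive 𝟏 = refl
antipode-involutive X = refl

antipode-AntiLetter : ∀ a → AntiLetter a (antipode a)
antipode-AntiLetter 𝟎 = a01
antipode-AntiLetter 𝟏 = a10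
antipode-AntiLetter X = aXX

antipode-fixed : ∀ {a} → a ≢ X → antipode a ≢ X
antipode-fixed {𝟎} _ ()
antipode-fixed {𝟏} _ ()
antipode-fixed {X} a≢X = contradiction refl a≢X

isFixed-fixed : ∀ {a} → a ≢ X → isFixed a ≡ 1
isFixed-fixed {𝟎} _ = refl
isFixed-fixed {𝟏} _ = refl
isFixed-fixed {X} a≢X = contradiction refl a≢X

isFixed-antipode : ∀ a → isFixed (antipode a) ≡ isFixed a
isFixed-antipode 𝟎 = refl
isFixed-antipode 𝟏 = refl
isFixed-antipode X = refl

fixed-distinct⇒antipode : ∀ {a b} → a ≢ X → b ≢ X → a ≢ b → antipode a ≡ b
fixed-distinct⇒antipode {𝟎} {𝟏} _ _ _ = refl
fixed-distinct⇒antipode {𝟏} {𝟎} _ _ _ = refl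
fixed-distinct⇒antipode {𝟎} {𝟎} _ _ a≢b = contradiction refl a≢b
fixed-distinct⇒antipode {𝟏} {𝟏} _ _ a≢b = contradiction refl a≢b
fixed-distinct⇒antipode {X} a≢X _ _ = contradiction refl a≢X
fixed-distinct⇒antipode {_} {X} _ b≢X _ = contradiction refl b≢X

data _≼_ : Letter → Letter → Set where
  ≼-free : ∀ {a} → a ≼ X
  ≼-refl : ∀ {a} → a ≼ a

≡⇒≼ : ∀ {a b} → a ≡ b → a ≼ b
≡⇒≼ refl = ≼-refl

≼X⇒≡X : ∀ {b} → X ≼ b → b ≡ X
≼X⇒≡X ≼-free = refl
≼X⇒≡X ≼-refl = refl

≼-agrees : ∀ {a b q} → a ≼ b → agrees a q → agrees b q
≼-agrees ≼-free _ = tt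
≼-agrees ≼-refl = id

_⊑_ : ∀ {d} → Word d → Word d → Set
v ⊑ w = ∀ l → v l ≼ w l

⊑⇒⊆∪ˡ : ∀ {d} {v r₁ r₂ : Word d} → v ⊑ r₁ → word v ⊆ r₁ ∪ r₂
⊑⇒⊆∪ˡ v⊑r₁ _ _ (inWord p∈v) = inj₁ λ l → ≼-agrees (v⊑r₁ l) (p∈v l)

⊑⇒⊆∪ʳ : ∀ {d} {v r₁ r₂ : Word d} → v ⊑ r₂ → word v ⊆ r₁ ∪ r₂
⊑⇒⊆∪ʳ v⊑r₂ _ _ (inWord p∈v) = inj₂ λ l → ≼-agrees (v⊑r₂ l) (p∈v l)

_[_]≔_ : ∀ {d} → Word d → Fin d → Letter → Word d
w [ i ]≔ a = updateAt w i (const a)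

⊑-update : ∀ {d} (g : Letter → Letter) {v w : Word d} {m a} →
  (∀ l → l ≢ m → g (v l) ≼ w l) → g a ≼ w m → (g ∘ (v [ m ]≔ a)) ⊑ w
⊑-update g {v} {m = m} off at l with l ≟ᶠ m
... | yes refl = subst (λ b → g b ≼ _) (sym (updateAt-updates l v)) at
... | no l≢m = subst (λ b → g b ≼ _) (sym (updateAt-minimal l m v l≢m)) (off l l≢m)

nfixed-update : ∀ {d} (w : Word d) i a →
  isFixed (w i) + nfixed (w [ i ]≔ a) ≡ isFixed a + nfixed w
nfixed-update w zero a = x∙yz≈y∙xz (isFixed (w zero)) (isFixed a) (nfixed (w ∘ suc))
nfixed-update w (suc i) a = begin
  isFixed (w (suc i)) + (isFixed (w zero) + nfixed ((w ∘ suc) [ i ]≔ a))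
    ≡⟨ x∙yz≈y∙xz (isFixed (w (suc i))) (isFixed (w zero)) _ ⟩
  isFixed (w zero) + (isFixed (w (suc i)) + nfixed ((w ∘ suc) [ i ]≔ a))
    ≡⟨ cong (isFixed (w zero) +_) (nfixed-update (w ∘ suc) i a) ⟩
  isFixed (w zero) + (isFixed a + nfixed (w ∘ suc))
    ≡⟨ x∙yz≈y∙xz (isFixed (w zero)) (isFixed a) _ ⟩
  isFixed a + nfixed w ∎
  where open ≡-Reasoning

nfixed-clear : ∀ {d} (w : Word d) {i} → w i ≢ X → suc (nfixed (w [ i ]≔ X)) ≡ nfixed w
nfixed-clear w {i} wi≢X =
  subst (λ n → n + nfixed (w [ i ]≔ X) ≡ nfixed w) (isFixed-fixed wi≢X) (nfixed-update w i X)

nfixed-fill : ∀ {d} (w : Word d) {i a} → w i ≡ X → a ≢ X → nfixed (w [ i ]≔ a) ≡ suc (nfixed w)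
nfixed-fill w {i} {a} wi≡X a≢X = begin
  nfixed (w [ i ]≔ a)                 ≡⟨ cong (λ b → isFixed b + nfixed (w [ i ]≔ a)) (sym wi≡X) ⟩
  isFixed (w i) + nfixed (w [ i ]≔ a) ≡⟨ nfixed-update w i a ⟩
  isFixed a + nfixed w                ≡⟨ cong (_+ nfixed w) (isFixed-fixed a≢X) ⟩
  suc (nfixed w)                      ∎
  where open ≡-Reasoning

nfixed-antipode : ∀ {d} (w : Word d) → nfixed (antipode ∘ w) ≡ nfixed w
nfixed-antipode {zero} w = refl
nfixed-antipode {suc d} w = cong₂ _+_ (isFixed-antipode (w zero)) (nfixed-antipode (w ∘ suc))

isFixed≡0⇒free : ∀ {a} → isFixed a ≡ 0 → a ≡ X
isFixed≡0⇒free {X} _ = refl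

nfixed≡0⇒free : ∀ {d} (w : Word d) → nfixed w ≡ 0 → ∀ l → w l ≡ X
nfixed≡0⇒free w n≡0 zero    = isFixed≡0⇒free (m+n≡0⇒m≡0 (isFixed (w zero)) n≡0)
nfixed≡0⇒free w n≡0 (suc l) = nfixed≡0⇒free (w ∘ suc) (m+n≡0⇒n≡0 (isFixed (w zero)) n≡0) l

nfixed≡suc⇒∃fixed : ∀ {d n} (w : Word d) → nfixed w ≡ suc n → Σ (Fin d) λ i → w i ≢ X
nfixed≡suc⇒∃fixed {suc d} {n} w n≡suc with w zero ≟ᴸ X
... | no w₀≢X = zero , w₀≢X
... | yes w₀≡X with nfixed≡suc⇒∃fixed (w ∘ suc) (subst (λ a → isFixed a + nfixed (w ∘ suc) ≡ suc n) w₀≡X n≡suc)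
...   | i , wi≢X = suc i , wi≢X

all-fixed⇒nfixed≡d : ∀ {d} (w : Word d) → (∀ l → w l ≢ X) → nfixed w ≡ d
all-fixed⇒nfixed≡d {zero} w _ = refl
all-fixed⇒nfixed≡d {suc d} w fixed =
  cong₂ _+_ (isFixed-fixed (fixed zero)) (all-fixed⇒nfixed≡d (w ∘ suc) (fixed ∘ suc))

ridge-partner : ∀ {d} {w : Word d} {i} → IsRidge w → w i ≢ X →
  Σ (Fin d) λ j → (j ≢ i) × (w j ≢ X) × (∀ l → l ≢ i → l ≢ j → w l ≡ X)
ridge-partner {w = w} {i} ρ wi≢X = j , j≢i , wj≢X , others-free
  where
  w₁ = w [ i ]≔ X
  nfixed-w₁ : nfixed w₁ ≡ 1
  nfixed-w₁ = suc-injective (trans (nfixed-clear w wi≢X) ρ)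
  fixed-in-w₁ = nfixed≡suc⇒∃fixed w₁ nfixed-w₁
  j = proj₁ fixed-in-w₁
  w₁j≢X : w₁ j ≢ X
  w₁j≢X = proj₂ fixed-in-w₁
  j≢i : j ≢ i
  j≢i j≡i = w₁j≢X (subst (λ l → w₁ l ≡ X) (sym j≡i) (updateAt-updates i w))
  wj≢X : w j ≢ X
  wj≢X = subst (_≢ X) (updateAt-minimal j i w j≢i) w₁j≢X
  w₂-free : ∀ l → (w₁ [ j ]≔ X) l ≡ X
  w₂-free = nfixed≡0⇒free _ (suc-injective (trans (nfixed-clear w₁ w₁j≢X) nfixed-w₁))
  others-free : ∀ l → l ≢ i → l ≢ j → w l ≡ X
  others-free l l≢i l≢j = begin
    w l                ≡⟨ updateAt-minimal l i w l≢i ⟨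
    w₁ l               ≡⟨ updateAt-minimal l j w₁ l≢j ⟨
    (w₁ [ j ]≔ X) l    ≡⟨ w₂-free l ⟩
    X                  ∎
    where open ≡-Reasoning

antipodal-peaks : ∀ {d} {r₁ r₂ : Word d} (F : Word d) → nfixed F ≡ 3 →
  F ⊑ r₁ → (antipode ∘ F) ⊑ r₂ → ContainsAntipodalPeaks r₁ r₂
antipodal-peaks F peak F⊑r₁ F̄⊑r₂ =
  word F , word (antipode ∘ F) , peak , trans (nfixed-antipode F) peak ,
  antiWord (antipode-AntiLetter ∘ F) , ⊑⇒⊆∪ˡ F⊑r₁ , ⊑⇒⊆∪ʳ F̄⊑r₂

antipodal-peaks-by-filling : ∀ {d} {r₁ r₂ : Word d} {m c} → IsRidge r₁ → r₁ m ≡ X → c ≢ X →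
  (∀ l → l ≢ m → antipode (r₁ l) ≼ r₂ l) → antipode c ≼ r₂ m →
  ContainsAntipodalPeaks r₁ r₂
antipodal-peaks-by-filling {r₁ = r₁} {m = m} {c} ρ r₁m≡X c≢X off at =
  antipodal-peaks (r₁ [ m ]≔ c) (trans (nfixed-fill r₁ r₁m≡X c≢X) (cong suc ρ))
    (⊑-update id (λ _ _ → ≼-refl) (subst (c ≼_) (sym r₁m≡X) ≼-free))
    (⊑-update antipode off at)

antipodal-ridge-peaks : ∀ {d} {r₁ r₂ : Word d} → IsRidge r₁ →
  (∀ l → antipode (r₁ l) ≼ r₂ l) → ContainsAntipodalPeaks r₁ r₂
antipodal-ridge-peaks {r₁ = r₁} {r₂} ρ opposite with any? (λ l → r₁ l ≟ᴸ X)
... | yes (m , r₁m≡X) = antipodal-peaks-by-filling ρ r₁m≡X (λ ()) (λ l _ → opposite l)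
        (subst (𝟏 ≼_) (sym r₂m≡X) ≼-free)
  where
  r₂m≡X : r₂ m ≡ X
  r₂m≡X = ≼X⇒≡X (subst (λ a → antipode a ≼ r₂ m) r₁m≡X (opposite m))
... | no no-free = empty , empty , d≡2 , d≡2 , antiEmpty , (λ _ _ ()) , (λ _ _ ())
  where
  d≡2 = trans (sym (all-fixed⇒nfixed≡d r₁ λ l r₁l≡X → no-free (l , r₁l≡X))) ρ

opposite-except : ∀ {d} {r₁ r₂ : Word d} {i k} → antipode (r₁ i) ≡ r₂ i →
  (∀ l → l ≢ i → l ≢ k → r₂ l ≡ X) → ∀ l → l ≢ k → antipode (r₁ l) ≼ r₂ l
opposite-except {i = i} opposite-i others-free l l≢k with l ≟ᶠ i
... | yes refl = ≡⇒≼ opposite-i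
... | no l≢i = subst (_ ≼_) (sym (others-free l l≢i l≢k)) ≼-free

everywhere : ∀ {d} {P : Fin d → Set} {k} → (∀ l → l ≢ k → P l) → P k → ∀ l → P l
everywhere {k = k} except at l with l ≟ᶠ k
... | yes refl = at
... | no l≢k = except l l≢k

¬both-fixed⇒free : ∀ {a b} → ¬ (a ≢ X × b ≢ X) → a ≡ X ⊎ b ≡ X
¬both-fixed⇒free {a} {b} ¬both with a ≟ᴸ X | b ≟ᴸ X
... | yes a≡X | _       = inj₁ a≡X
... | no _    | yes b≡X = inj₂ b≡X
... | no a≢X  | no b≢X  = contradiction (a≢X , b≢X) ¬both

lemma4 : (d : ℕ) (r₁ r₂ : Word d) → IsRidge r₁ → IsRidge r₂
    → ¬ ContainsAntipodalPeaks r₁ r₂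
    → (Σ (Fin d) λ i → (r₁ i ≢ X) × (r₁ i ≡ r₂ i))
      ⊎ (∀ i → (r₁ i ≡ X) ⊎ (r₂ i ≡ X))
lemma4 d r₁ r₂ ρ₁ ρ₂ ¬peaks with any? (λ l → ¬? (r₁ l ≟ᴸ X) ×-dec ¬? (r₂ l ≟ᴸ X))
... | no ¬shared = inj₂ λ l → ¬both-fixed⇒free λ both → ¬shared (l , both)
... | yes (i , r₁i≢X , r₂i≢X) with r₁ i ≟ᴸ r₂ i
...   | yes r₁i≡r₂i = inj₁ (i , r₁i≢X , r₁i≡r₂i)
...   | no r₁i≢r₂i
  with fixed-distinct⇒antipode r₁i≢X r₂i≢X r₁i≢r₂i | ridge-partner ρ₁ r₁i≢X | ridge-partner ρ₂ r₂i≢X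
...     | opposite-i | j , _ , r₁j≢X , r₁-free | k , k≢i , r₂k≢X , r₂-free with k ≟ᶠ j
...       | no k≢j = contradiction
                (antipodal-peaks-by-filling ρ₁ (r₁-free k k≢i k≢j) (antipode-fixed r₂k≢X)
                   (opposite-except opposite-i r₂-free) (≡⇒≼ (antipode-involutive (r₂ k))))
                ¬peaks
...       | yes refl with r₁ k ≟ᴸ r₂ k
...         | yes r₁k≡r₂k = inj₁ (k , r₁j≢X , r₁k≡r₂k)
...         | no r₁k≢r₂k = contradiction
                (antipodal-ridge-peaks ρ₁ (everywhere (opposite-except opposite-i r₂-free)
                   (≡⇒≼ (fixed-distinct⇒antipode r₁j≢X r₂k≢X r₁k≢r₂k))))
                ¬peaks
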